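{- Let $\mathbf A\in\mathbb V(\mathbf{3_{dblst}},\mathbf{4_{dmba}})$ and $x\in A$. Then (a) $x'\lor x'^*=1$, and (b) $x'^{**}=x'$.
   Context: Signature $\langle \lor,\land,{}^*,{}',0,1\rangle$. $\mathbb V(\mathbf K)$ is the variety generated by $\mathbf K$. $\mathbf{3_{dblst}}$ is the chain $0<c<1$ with $0^*=1, c^*=0, 1^*=0$ and $0'=1, c'=1, 1'=0$. $\mathbf{4_{dmba}}$ is the four-element Boolean lattice $\{0,a,b,1\}$ with ${}^*$ the Boolean complement ($a^*=b$, $b^*=a$) and $0'=1, 1'=0, a'=a, b'=b$. -}

module Defs where

open import Level using (Level; suc; _⊔_)
open import Data.Nat using (ℕ)
open import Relation.Binary.PropositionalEquality using (_≡_)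

record Alg (a : Level) : Set (suc a) where
  field
    Carrier : Set a
    _∨_ _∧_ : Carrier → Carrier → Carrier
    _* _′ : Carrier → Carrier
    𝟘 𝟙 : Carrier

data Term : Set where
  var : ℕ → Term
  _∨ₜ_ _∧ₜ_ : Term → Term → Term
  _*ₜ _′ₜ : Term → Term
  0ₜ 1ₜ : Term

⟦_⟧ : ∀ {a} {A : Alg a} → Term → (ℕ → Alg.Carrier A) → Alg.Carrier A
⟦_⟧ {A = A} (var n) ρ = ρ n
⟦_⟧ {A = A} (t ∨ₜ u) ρ = Alg._∨_ A (⟦_⟧ {A = A} t ρ) (⟦_⟧ {A = A} u ρ)
⟦_⟧ {A = A} (t ∧ₜ u) ρ = Alg._∧_ A (⟦_⟧ {A = A} t ρ) (⟦_⟧ {A = A} u ρ)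
⟦_⟧ {A = A} (t *ₜ) ρ = Alg._* A (⟦_⟧ {A = A} t ρ)
⟦_⟧ {A = A} (t ′ₜ) ρ = Alg._′ A (⟦_⟧ {A = A} t ρ)
⟦_⟧ {A = A} 0ₜ ρ = Alg.𝟘 A
⟦_⟧ {A = A} 1ₜ ρ = Alg.𝟙 A

_⊨_≈_ : ∀ {a} → Alg a → Term → Term → Set a
A ⊨ t ≈ u = (ρ : ℕ → Alg.Carrier A) → ⟦_⟧ {A = A} t ρ ≡ ⟦_⟧ {A = A} u ρ

-- 3_dblst : the chain 0 < c < 1
data Three : Set where
  z c o : Three

3-∨ : Three → Three → Three
3-∨ z y = y
3-∨ c z = c
3-∨ c c = c
3-∨ c o = o
3-∨ o y = o

3-∧ : Three → Three → Three
3-∧ z y = z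
3-∧ c z = z
3-∧ c c = c
3-∧ c o = c
3-∧ o y = y

3-* : Three → Three
3-* z = o
3-* c = z
3-* o = z

3-′ : Three → Three
3-′ z = o
3-′ c = o
3-′ o = z

3dblst : Alg Level.zero
3dblst = record
  { Carrier = Three ; _∨_ = 3-∨ ; _∧_ = 3-∧ ; _* = 3-* ; _′ = 3-′ ; 𝟘 = z ; 𝟙 = o }

-- 4_dmba : the four-element Boolean lattice {0, a, b, 1}
data Four : Set where
  f0 fa fb f1 : Four

4-∨ : Four → Four → Four
4-∨ f0 y = y
4-∨ f1 y = f1
4-∨ fa f0 = fa
4-∨ fa fa = fa
4-∨ fa fb = f1
4-∨ fa f1 = f1
4-∨ fb f0 = fb
4-∨ fb fa = f1
4-∨ fb fb = fb
4-∨ fb f1 = f1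

4-∧ : Four → Four → Four
4-∧ f0 y = f0
4-∧ f1 y = y
4-∧ fa f0 = f0
4-∧ fa fa = fa
4-∧ fa fb = f0
4-∧ fa f1 = fa
4-∧ fb f0 = f0
4-∧ fb fa = f0
4-∧ fb fb = fb
4-∧ fb f1 = fb

4-* : Four → Four
4-* f0 = f1
4-* fa = fb
4-* fb = fa
4-* f1 = f0

4-′ : Four → Four
4-′ f0 = f1
4-′ fa = fa
4-′ fb = fb
4-′ f1 = f0

4dmba : Alg Level.zero
4dmba = record
  { Carrier = Four ; _∨_ = 4-∨ ; _∧_ = 4-∧ ; _* = 4-* ; _′ = 4-′ ; 𝟘 = f0 ; 𝟙 = f1 }

-- A ∈ 𝕍(3_dblst, 4_dmba): by Birkhoff's HSP theorem, the variety generated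
-- by K is the class of all algebras satisfying every identity that holds
-- in every member of K.
InV-3dblst-4dmba : ∀ {a} → Alg a → Set a
InV-3dblst-4dmba A =
  (t u : Term) → 3dblst ⊨ t ≈ u → 4dmba ⊨ t ≈ u → A ⊨ t ≈ u

{-# OPTIONS --safe #-}
module Submission where

-- In both generators the image of ′ consists of complemented elements
-- ({0, 1} in the chain, everything in the Boolean lattice), so x′ ∨ x′* ≈ 1
-- and x′** ≈ x′ hold there and hence throughout the variety.

open import Defs
open import Level using (Level)
open import Data.Nat using (ℕ)
open import Data.Product using (_×_; _,_)
open import Relation.Binary.PropositionalEquality using (_≡_; refl)

3-′∨′*≡o : ∀ x → 3-∨ (3-′ x) (3-* (3-′ x)) ≡ o
3-′∨′*≡o z = refl
3-′∨′*≡o c = refl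
3-′∨′*≡o o = refl

3-′**≡′ : ∀ x → 3-* (3-* (3-′ x)) ≡ 3-′ x
3-′**≡′ z = refl
3-′**≡′ c = refl
3-′**≡′ o = refl

4-′∨′*≡f1 : ∀ x → 4-∨ (4-′ x) (4-* (4-′ x)) ≡ f1
4-′∨′*≡f1 f0 = refl
4-′∨′*≡f1 fa = refl
4-′∨′*≡f1 fb = refl
4-′∨′*≡f1 f1 = refl

4-′**≡′ : ∀ x → 4-* (4-* (4-′ x)) ≡ 4-′ x
4-′**≡′ f0 = refl
4-′**≡′ fa = refl
4-′**≡′ fb = refl
4-′**≡′ f1 = refl

x′ : Term
x′ = var 0 ′ₜ

lemma3p5 : ∀ {a : Level} (A : Alg a) → InV-3dblst-4dmba A →
    (x : Alg.Carrier A) →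
      (Alg._∨_ A (Alg._′ A x) (Alg._* A (Alg._′ A x)) ≡ Alg.𝟙 A)
      × (Alg._* A (Alg._* A (Alg._′ A x)) ≡ Alg._′ A x)
lemma3p5 A A∈V x =
    A∈V (x′ ∨ₜ (x′ *ₜ)) 1ₜ (λ ρ → 3-′∨′*≡o (ρ 0)) (λ ρ → 4-′∨′*≡f1 (ρ 0)) at-x
  , A∈V ((x′ *ₜ) *ₜ) x′ (λ ρ → 3-′**≡′ (ρ 0)) (λ ρ → 4-′**≡′ (ρ 0)) at-x
  where
    at-x : ℕ → Alg.Carrier A
    at-x _ = x
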